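{- Let $q$ be a power of an odd prime and let $e\ge 3$ be an integer. The nonnegative integer solutions $(c_1,\dots,c_{e-1})$ of the system \[ \sum_{j=1}^{e-1}c_j(q^j-2)\equiv 0\pmod{q^e-1},\qquad \sum_{j=1}^{e-1}c_j=q^2-1 \] are exactly the following: (i) if $e\ge 5$: $(c_1,\dots,c_{e-1})=(q-1,1,0,\dots,0,q,q^2-2q-1)$ (that is, $c_1=q-1$, $c_2=1$, $c_{e-2}=q$, $c_{e-1}=q^2-2q-1$, all other $c_j=0$) and $(c_1,\dots,c_{e-1})=(2q-1,0,\dots,0,q^2-2q)$ (that is, $c_1=2q-1$, $c_{e-1}=q^2-2q$, all other $c_j=0$); (ii) if $e=4$: $(c_1,c_2,c_3)=(q-1,q+1,q^2-2q-1)$ and $(c_1,c_2,c_3)=(2q-1,0,q^2-2q)$; (iii) if $e=3$: only $(c_1,c_2)=(2q-1,q^2-2q)$. -}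

module Defs where

open import Data.Nat using (ℕ; zero; suc; _+_; _*_; _∸_; _^_; _≤_; _≟_)
open import Data.Nat.Divisibility using (_∣_)
open import Data.Nat.Primality using (Prime)
open import Data.Fin using (Fin; toℕ)
import Data.Fin as F
open import Data.Bool using (Bool; if_then_else_)
open import Data.Product using (∃; _×_)
open import Relation.Binary.PropositionalEquality using (_≡_; _≢_)
open import Relation.Nullary.Decidable using (does)

∑ : (n : ℕ) → (Fin n → ℕ) → ℕ
∑ zero    f = 0
∑ (suc n) f = f F.zero + ∑ n (λ i → f (F.suc i))

OddPrimePower : ℕ → Set
OddPrimePower q = ∃ λ p → ∃ λ k → Prime p × p ≢ 2 × 1 ≤ k × q ≡ p ^ k

-- A tuple (c_1,…,c_{e-1}) is represented as c : Fin (e ∸ 1) → ℕ,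
-- where c i stands for c_j with j = idx i = toℕ i + 1.
idx : ∀ {n} → Fin n → ℕ
idx i = suc (toℕ i)

-- The system of the lemma (in nonnegative integers c_j):
--   Σ_{j=1}^{e-1} c_j (q^j - 2) ≡ 0 (mod q^e - 1)  and  Σ_{j=1}^{e-1} c_j = q^2 - 1.
-- (For q ≥ 3 and j ≥ 1 we have q^j ≥ 3, so natural subtraction is exact.)
IsSolution : (q e : ℕ) → (Fin (e ∸ 1) → ℕ) → Set
IsSolution q e c =
  ((q ^ e) ∸ 1) ∣ ∑ (e ∸ 1) (λ i → c i * ((q ^ idx i) ∸ 2))
  × ∑ (e ∸ 1) c ≡ (q ^ 2) ∸ 1

_==_ : ℕ → ℕ → Bool
m == n = does (m ≟ n)

solA5 : (q e j : ℕ) → ℕ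
solA5 q e j =
  if j == 1 then q ∸ 1 else
  if j == 2 then 1 else
  if j == (e ∸ 2) then q else
  if j == (e ∸ 1) then (q ^ 2) ∸ (2 * q) ∸ 1 else 0

solA4 : (q j : ℕ) → ℕ
solA4 q j =
  if j == 1 then q ∸ 1 else
  if j == 2 then q + 1 else
  if j == 3 then (q ^ 2) ∸ (2 * q) ∸ 1 else 0

solB : (q e j : ℕ) → ℕ
solB q e j =
  if j == 1 then (2 * q) ∸ 1 else
  if j == (e ∸ 1) then (q ^ 2) ∸ (2 * q) else 0

module Submission where

-- For c = (c_1,…,c_{e-1}) write K = Σ c_j for its size and
-- W = Σ c_j q^{j-1} for its base-q weight (digits may exceed q).  Since
-- c_j (q^j - 2) + 2 c_j = q · c_j q^{j-1}, the congruence says q·W - 2K is a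
-- multiple m (q^e - 1).  As K = q² - 1 ≡ -1 (mod q), m ≡ -2 (mod q), and the bound
-- W ≤ K q^{e-2} leaves only m = q - 2.  So the system is equivalent to the
-- reduced system   K = q² - 1,  W = (q-2) q^{e-1} + 2q - 1.
-- The reduced system is solved digit by digit from the bottom: the lowest digit is
-- fixed modulo q, and a carry a out of it costs a·q^{m+1} of weight but only a of
-- size, which the bound W ≤ K q^m forbids except in the cases that produce the
-- listed solutions.

open import Defs
open import Data.Nat using (ℕ; zero; suc; _+_; _*_; _∸_; _^_; _≤_; _<_; z≤n; s≤s; NonZero)
open import Data.Nat.Properties
open import Data.Nat.DivMod using (_%_; _/_; m≡m%n+[m/n]*n; [m+kn]%n≡m%n; m<n⇒m%n≡m)
open import Data.Nat.Divisibility using (divides)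
open import Data.Nat.Primality using (¬prime[0]; ¬prime[1])
open import Data.Fin using (Fin; toℕ) renaming (zero to fz; suc to fs)
open import Data.Vec.Functional using (tail)
open import Data.Bool using (if_then_else_)
open import Data.Product using (_×_; _,_; proj₁; proj₂; ∃; uncurry)
open import Data.Sum using (_⊎_; inj₁; inj₂; [_,_])
open import Data.Empty using (⊥-elim)
open import Function using (_∘_)
open import Function.Bundles using (_⇔_; mk⇔)
open import Relation.Nullary using (¬_)
open import Relation.Binary.PropositionalEquality
  using (_≡_; refl; sym; trans; cong; cong₂; subst; _≗_; module ≡-Reasoning)
open import Algebra.Properties.CommutativeSemigroup +-commutativeSemigroup using (interchange)
open import Algebra.Properties.CommutativeSemigroup *-commutativeSemigroup using (x∙yz≈y∙xz)
open import Data.Nat.Tactic.RingSolver using (solve-∀)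

∑-cong : ∀ n {f g : Fin n → ℕ} → f ≗ g → ∑ n f ≡ ∑ n g
∑-cong zero    f≗g = refl
∑-cong (suc n) f≗g = cong₂ _+_ (f≗g fz) (∑-cong n (λ i → f≗g (fs i)))

∑-+ : ∀ n (f g : Fin n → ℕ) → ∑ n (λ i → f i + g i) ≡ ∑ n f + ∑ n g
∑-+ zero    f g = refl
∑-+ (suc n) f g = trans (cong (f fz + g fz +_) (∑-+ n (tail f) (tail g))) (interchange (f fz) (g fz) _ _)

∑-*ˡ : ∀ n k (f : Fin n → ℕ) → ∑ n (λ i → k * f i) ≡ k * ∑ n f
∑-*ˡ zero    k f = sym (*-zeroʳ k)
∑-*ˡ (suc n) k f = trans (cong (k * f fz +_) (∑-*ˡ n k (tail f))) (sym (*-distribˡ-+ k (f fz) _))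

weight : ℕ → (n : ℕ) → (Fin n → ℕ) → ℕ
weight q n f = ∑ n (λ i → f i * q ^ toℕ i)

weight-suc : ∀ q n (f : Fin (suc n) → ℕ) → weight q (suc n) f ≡ f fz + q * weight q n (tail f)
weight-suc q n f = cong₂ _+_ (*-identityʳ (f fz))
  (trans (∑-cong n (λ i → x∙yz≈y∙xz (f (fs i)) q (q ^ toℕ i))) (∑-*ˡ n q _))

weight-one : ∀ q (f : Fin 1 → ℕ) → weight q 1 f ≡ ∑ 1 f
weight-one q f = cong (_+ 0) (*-identityʳ (f fz))

weight-cong : ∀ q n {f g : Fin n → ℕ} → f ≗ g → weight q n f ≡ weight q n g
weight-cong q n f≗g = ∑-cong n (λ i → cong (_* q ^ toℕ i) (f≗g i))

weight≤ : ∀ {q} .{{_ : NonZero q}} n (f : Fin (suc n) → ℕ) → weight q (suc n) f ≤ ∑ (suc n) f * q ^ n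
weight≤ {q} zero f = ≤-reflexive (trans (weight-one q f) (sym (*-identityʳ _)))
weight≤ {q} (suc n) f = begin
    weight q (suc (suc n)) f
  ≡⟨ weight-suc q (suc n) f ⟩
    f fz + q * weight q (suc n) (tail f)
  ≤⟨ +-mono-≤ (m≤m*n (f fz) (q ^ suc n)) (*-monoʳ-≤ q (weight≤ n (tail f))) ⟩
    f fz * q ^ suc n + q * (∑ (suc n) (tail f) * q ^ n)
  ≡⟨ cong (f fz * q ^ suc n +_) (x∙yz≈y∙xz q (∑ (suc n) (tail f)) (q ^ n)) ⟩
    f fz * q ^ suc n + ∑ (suc n) (tail f) * q ^ suc n
  ≡⟨ *-distribʳ-+ (q ^ suc n) (f fz) _ ⟨
    ∑ (suc (suc n)) f * q ^ suc n ∎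
  where
  open ≤-Reasoning
  instance _ = m^n≢0 q (suc n)

weighted-sum : ∀ {q} .{{_ : NonZero q}} → 1 < q → ∀ n (c : Fin n → ℕ) →
  ∑ n (λ i → c i * (q ^ idx i ∸ 2)) + 2 * ∑ n c ≡ q * weight q n c
weighted-sum {q} 1<q n c = begin
    ∑ n (λ i → c i * (q ^ idx i ∸ 2)) + 2 * ∑ n c
  ≡⟨ cong (∑ n (λ i → c i * (q ^ idx i ∸ 2)) +_) (∑-*ˡ n 2 c) ⟨
    ∑ n (λ i → c i * (q ^ idx i ∸ 2)) + ∑ n (λ i → 2 * c i)
  ≡⟨ ∑-+ n _ _ ⟨
    ∑ n (λ i → c i * (q ^ idx i ∸ 2) + 2 * c i)
  ≡⟨ ∑-cong n (λ i → term (c i) (toℕ i)) ⟩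
    ∑ n (λ i → q * (c i * q ^ toℕ i))
  ≡⟨ ∑-*ˡ n q _ ⟩
    q * weight q n c ∎
  where
  open ≡-Reasoning
  term : ∀ x j → x * (q ^ suc j ∸ 2) + 2 * x ≡ q * (x * q ^ j)
  term x j = begin
      x * (q ^ suc j ∸ 2) + 2 * x   ≡⟨ cong (x * (q ^ suc j ∸ 2) +_) (*-comm 2 x) ⟩
      x * (q ^ suc j ∸ 2) + x * 2   ≡⟨ *-distribˡ-+ x _ 2 ⟨
      x * (q ^ suc j ∸ 2 + 2)       ≡⟨ cong (x *_) (m∸n+n≡m 2≤q^[1+j]) ⟩
      x * (q * q ^ j)               ≡⟨ x∙yz≈y∙xz x q (q ^ j) ⟩
      q * (x * q ^ j)               ∎
    where
    instance _ = m^n≢0 q j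
    2≤q^[1+j] : 2 ≤ q ^ suc j
    2≤q^[1+j] = ≤-trans 1<q (m≤m*n q (q ^ j))

excess : ∀ {x y} z → x ≡ y + suc z → ¬ (x ≤ y)
excess {x} {y} z eq le = m+1+n≰m y (subst (_≤ y) eq le)

-- Division with remainder is unique: x + qX = ρ + qN with ρ < q means x = ρ + a q,
-- where a is the carry, and then a + X = N.
digit : ∀ {q ρ x X N} .{{_ : NonZero q}} → ρ < q → x + q * X ≡ ρ + q * N →
        ∃ λ a → x ≡ ρ + a * q × a + X ≡ N
digit {q} {ρ} {x} {X} {N} ρ<q eq = x / q , x≡ρ+aq , *-cancelˡ-≡ _ _ q (+-cancelˡ-≡ ρ _ _ (begin
    ρ + q * (x / q + X)       ≡⟨ cong (ρ +_) (*-distribˡ-+ q (x / q) X) ⟩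
    ρ + (q * (x / q) + q * X) ≡⟨ cong (λ y → ρ + (y + q * X)) (*-comm q (x / q)) ⟩
    ρ + (x / q * q + q * X)   ≡⟨ +-assoc ρ _ _ ⟨
    ρ + x / q * q + q * X     ≡⟨ cong (_+ q * X) x≡ρ+aq ⟨
    x + q * X                 ≡⟨ eq ⟩
    ρ + q * N                 ∎))
  where
  open ≡-Reasoning
  x%q≡ρ : x % q ≡ ρ
  x%q≡ρ = begin
    x % q           ≡⟨ [m+kn]%n≡m%n x X q ⟨
    (x + X * q) % q ≡⟨ cong (λ y → (x + y) % q) (*-comm X q) ⟩
    (x + q * X) % q ≡⟨ cong (_% q) eq ⟩
    (ρ + q * N) % q ≡⟨ cong (λ y → (ρ + y) % q) (*-comm q N) ⟩
    (ρ + N * q) % q ≡⟨ [m+kn]%n≡m%n ρ N q ⟩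
    ρ % q           ≡⟨ m<n⇒m%n≡m ρ<q ⟩
    ρ               ∎
  x≡ρ+aq : x ≡ ρ + x / q * q
  x≡ρ+aq = trans (m≡m%n+[m/n]*n x q) (cong (_+ x / q * q) x%q≡ρ)

lowest-digit : ∀ {q ρ N K n} .{{_ : NonZero q}} → ρ < q → (f : Fin (suc n) → ℕ) →
  weight q (suc n) f ≡ ρ + q * N → ∑ (suc n) f ≡ ρ + K →
  ∃ λ a → f fz ≡ ρ + a * q × weight q n (tail f) + a ≡ N × ∑ n (tail f) + a * q ≡ K
lowest-digit {q} {ρ} {N} {K} {n} ρ<q f W≡ ∑≡
  with digit ρ<q (trans (sym (weight-suc q n f)) W≡)
... | a , f₀≡ , a+W≡N = a , f₀≡ , trans (+-comm _ a) a+W≡N , +-cancelˡ-≡ ρ _ _ (begin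
    ρ + (∑ n (tail f) + a * q) ≡⟨ cong (ρ +_) (+-comm _ (a * q)) ⟩
    ρ + (a * q + ∑ n (tail f)) ≡⟨ +-assoc ρ _ _ ⟨
    ρ + a * q + ∑ n (tail f)   ≡⟨ cong (_+ ∑ n (tail f)) f₀≡ ⟨
    ∑ (suc n) f                ≡⟨ ∑≡ ⟩
    ρ + K                      ∎)
  where open ≡-Reasoning

-- The price of a carry: the remaining digits must reach weight N - a with size K - a q,
-- so by weight≤ we need N + a q^{m+1} ≤ K q^m + a.
carry-bound : ∀ {q m a N K} .{{_ : NonZero q}} (g : Fin (suc m) → ℕ) →
  weight q (suc m) g + a ≡ N → ∑ (suc m) g + a * q ≡ K → N + a * q ^ suc m ≤ K * q ^ m + a
carry-bound {q} {m} {a} {N} {K} g W≡ ∑≡ = begin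
    N + a * q ^ suc m
  ≡⟨ cong (_+ a * q ^ suc m) W≡ ⟨
    weight q (suc m) g + a + a * q ^ suc m
  ≤⟨ +-monoˡ-≤ (a * q ^ suc m) (+-monoˡ-≤ a (weight≤ m g)) ⟩
    ∑ (suc m) g * q ^ m + a + a * q ^ suc m
  ≡⟨ regroup (∑ (suc m) g) a q (q ^ m) ⟩
    (∑ (suc m) g + a * q) * q ^ m + a
  ≡⟨ cong (λ k → k * q ^ m + a) ∑≡ ⟩
    K * q ^ m + a ∎
  where
  open ≤-Reasoning
  regroup : ∀ s a q t → s * t + a + a * (q * t) ≡ (s + a * q) * t + a
  regroup = solve-∀

absorb : ∀ {a A B Q} → 1 < Q → A ≤ B → a + A ≡ a * Q + B → a ≡ 0 × A ≡ B
absorb {zero}              1<Q A≤B eq = refl , eq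
absorb {suc a} {A} {B} {Q} 1<Q A≤B eq =
  ⊥-elim (<-irrefl eq (≤-<-trans (+-monoʳ-≤ (suc a) A≤B) (+-monoˡ-< B (m<m*n (suc a) Q 1<Q))))

atTop : (n v : ℕ) → Fin (suc n) → ℕ
atTop n v i = if toℕ i == n then v else 0

-- Equality in weight≤ forces all digits to the top position (needs q ≥ 2).
top-unique : ∀ {q} .{{_ : NonZero q}} → 1 < q → ∀ n v (f : Fin (suc n) → ℕ) →
  weight q (suc n) f ≡ v * q ^ n → ∑ (suc n) f ≡ v → f ≗ atTop n v
top-unique 1<q zero v f W≡ ∑≡ fz = trans (sym (+-identityʳ (f fz))) ∑≡
top-unique {q} 1<q (suc n) v f W≡ ∑≡ = λ
  { fz     → proj₁ absorbed
  ; (fs i) → top-unique 1<q n v (tail f) W'≡ ∑'≡ i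
  }
  where
  open ≡-Reasoning
  K' = ∑ (suc n) (tail f)
  expand : ∀ a k q t → (a + k) * (q * t) ≡ a * (q * t) + q * (k * t)
  expand = solve-∀
  instance _ = m^n≢0 q n
  absorbed = absorb (<-≤-trans 1<q (m≤m*n q (q ^ n))) (*-monoʳ-≤ q (weight≤ n (tail f))) (begin
      f fz + q * weight q (suc n) (tail f) ≡⟨ weight-suc q (suc n) f ⟨
      weight q (suc (suc n)) f             ≡⟨ W≡ ⟩
      v * q ^ suc n                        ≡⟨ cong (_* q ^ suc n) ∑≡ ⟨
      (f fz + K') * q ^ suc n              ≡⟨ expand (f fz) K' q (q ^ n) ⟩
      f fz * q ^ suc n + q * (K' * q ^ n)  ∎)
  ∑'≡ : K' ≡ v
  ∑'≡ = trans (cong (_+ K') (sym (proj₁ absorbed))) ∑≡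
  W'≡ : weight q (suc n) (tail f) ≡ v * q ^ n
  W'≡ = trans (*-cancelˡ-≡ _ _ q (proj₂ absorbed)) (cong (_* q ^ n) ∑'≡)

weight-atTop : ∀ q n v → weight q (suc n) (atTop n v) ≡ v * q ^ n
weight-atTop q zero    v = +-identityʳ _
weight-atTop q (suc n) v = trans (weight-suc q (suc n) (atTop (suc n) v))
  (trans (cong (q *_) (weight-atTop q n v)) (x∙yz≈y∙xz q v (q ^ n)))

∑-atTop : ∀ n v → ∑ (suc n) (atTop n v) ≡ v
∑-atTop zero    v = +-identityʳ v
∑-atTop (suc n) v = ∑-atTop n v

atTop2 : (n u v : ℕ) → Fin (2 + n) → ℕ
atTop2 n u v i = if toℕ i == n then u else if toℕ i == suc n then v else 0

weight-atTop2 : ∀ q n u v → weight q (2 + n) (atTop2 n u v) ≡ (u + v * q) * q ^ n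
weight-atTop2 q zero    u v = lowTwo u v q
  where
  lowTwo : ∀ u v q → u * 1 + (v * (q * 1) + 0) ≡ (u + v * q) * 1
  lowTwo = solve-∀
weight-atTop2 q (suc n) u v = trans (weight-suc q (2 + n) (atTop2 (suc n) u v))
  (trans (cong (q *_) (weight-atTop2 q n u v)) (x∙yz≈y∙xz q (u + v * q) (q ^ n)))

∑-atTop2 : ∀ n u v → ∑ (2 + n) (atTop2 n u v) ≡ u + v
∑-atTop2 zero    u v = cong (u +_) (+-identityʳ v)
∑-atTop2 (suc n) u v = ∑-atTop2 n u v

-- The constants of the problem are named by their value in q;
-- ring identities are stated as closed polynomial identities in r, since the ring
-- solver does not unfold definitions.
module _ (r : ℕ) where

  q q-1 q-2 2q-1 q²-1 q²-q q²-2q q²-q-1 q²-2q-1 : ℕ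
  q       = 3 + r
  q-1     = 2 + r
  q-2     = 1 + r
  2q-1    = 5 + 2 * r
  q²-1    = 8 + 6 * r + r * r
  q²-q    = q * q-1
  q²-2q   = q * q-2
  q²-q-1  = 5 + 5 * r + r * r
  q²-2q-1 = 2 + 4 * r + r * r

  1<q : 1 < q
  1<q = s≤s (s≤s z≤n)

  q^2∸1 : q ^ 2 ∸ 1 ≡ q²-1
  q^2∸1 = cong (_∸ 1) (square r)
    where
    square : ∀ r → (3 + r) * ((3 + r) * 1) ≡ 1 + (8 + 6 * r + r * r)
    square = solve-∀

  2q∸1 : 2 * q ∸ 1 ≡ 2q-1
  2q∸1 = cong (_∸ 1) (double r)
    where
    double : ∀ r → 2 * (3 + r) ≡ 1 + (5 + 2 * r)
    double = solve-∀

  q^2∸2q : q ^ 2 ∸ 2 * q ≡ q²-2q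
  q^2∸2q = trans (cong (_∸ 2 * q) (square r)) (m+n∸m≡n (2 * q) q²-2q)
    where
    square : ∀ r → (3 + r) * ((3 + r) * 1) ≡ 2 * (3 + r) + (3 + r) * (1 + r)
    square = solve-∀

  q^2∸2q∸1 : q ^ 2 ∸ 2 * q ∸ 1 ≡ q²-2q-1
  q^2∸2q∸1 = trans (cong (_∸ 1) q^2∸2q) (cong (_∸ 1) (product r))
    where
    product : ∀ r → (3 + r) * (1 + r) ≡ 1 + (2 + 4 * r + r * r)
    product = solve-∀

  Reduced : (t : ℕ) → (Fin (2 + t) → ℕ) → Set
  Reduced t c = ∑ (2 + t) c ≡ q²-1 × weight q (2 + t) c ≡ q-2 * q ^ (2 + t) + 2q-1

  -- A solution has q W = m (q^e - 1) + 2K; reducing mod q gives m + 2 = j q, and j = 1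
  -- (m = q - 2) is the only value compatible with weight≤.
  solution⇒reduced : ∀ t (c : Fin (2 + t) → ℕ) → IsSolution q (3 + t) c → Reduced t c
  solution⇒reduced t c (divides m S≡mP , ∑≡) = ∑c≡q²-1 , weight≡ (digit 0<q carry-eq)
    where
    P E W : ℕ
    P = q ^ (3 + t) ∸ 1
    E = q ^ (2 + t)
    W = weight q (2 + t) c
    0<q : 0 < q
    0<q = s≤s z≤n
    qE≡1+P : q * E ≡ 1 + P
    qE≡1+P = sym (m+[n∸m]≡n (m^n>0 q (3 + t)))
    ∑c≡q²-1 : ∑ (2 + t) c ≡ q²-1
    ∑c≡q²-1 = trans ∑≡ q^2∸1
    qW≡ : q * W ≡ m * P + 2 * q²-1
    qW≡ = trans (sym (weighted-sum 1<q (2 + t) c)) (cong₂ _+_ S≡mP (cong (2 *_) ∑c≡q²-1))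
    step₁ : ∀ m P r → m + 2 + (m * P + 2 * (8 + 6 * r + r * r)) ≡ m * (1 + P) + 2 * (9 + 6 * r + r * r)
    step₁ = solve-∀
    step₂ : ∀ m E r → m * ((3 + r) * E) + 2 * (9 + 6 * r + r * r) ≡ 0 + (3 + r) * (m * E + 2 * (3 + r))
    step₂ = solve-∀
    carry-eq : m + 2 + q * W ≡ 0 + q * (m * E + 2 * q)
    carry-eq = begin
        m + 2 + q * W                         ≡⟨ cong (m + 2 +_) qW≡ ⟩
        m + 2 + (m * P + 2 * q²-1)            ≡⟨ step₁ m P r ⟩
        m * (1 + P) + 2 * (9 + 6 * r + r * r) ≡⟨ cong (λ x → m * x + 2 * (9 + 6 * r + r * r)) qE≡1+P ⟨
        m * (q * E) + 2 * (9 + 6 * r + r * r) ≡⟨ step₂ m E r ⟩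
        0 + q * (m * E + 2 * q)               ∎
      where open ≡-Reasoning
    weight≡ : (∃ λ j → m + 2 ≡ 0 + j * q × j + W ≡ m * E + 2 * q) → W ≡ q-2 * E + 2q-1
    weight≡ (zero , m+2≡0 , _) = ⊥-elim (m+1+n≢0 m m+2≡0)
    weight≡ (suc zero , m+2≡q , 1+W≡) =
      suc-injective (trans 1+W≡ (trans (cong (λ x → x * E + 2 * q) m≡q-2) (unfold r E)))
      where
      shift : ∀ r → 0 + 1 * (3 + r) ≡ 1 + r + 2
      shift = solve-∀
      m≡q-2 : m ≡ q-2
      m≡q-2 = +-cancelʳ-≡ 2 m q-2 (trans m+2≡q (shift r))
      unfold : ∀ r E → (1 + r) * E + 2 * (3 + r) ≡ 1 + ((1 + r) * E + (5 + 2 * r))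
      unfold = solve-∀
    weight≡ (suc (suc j) , m+2≡ , j+W≡) = ⊥-elim (too-large (q ^ (1 + t)) (m^n>0 q (1 + t)) (begin
        m * E + 2 * q                       ≡⟨ j+W≡ ⟨
        2 + j + W                           ≤⟨ +-monoʳ-≤ (2 + j) (weight≤ (1 + t) c) ⟩
        2 + j + ∑ (2 + t) c * q ^ (1 + t)   ≡⟨ cong (λ x → 2 + j + x * q ^ (1 + t)) ∑c≡q²-1 ⟩
        2 + j + q²-1 * q ^ (1 + t)          ∎))
      where
      open ≤-Reasoning
      shift : ∀ j r → 0 + (2 + j) * (3 + r) ≡ 4 + 3 * j + 2 * r + j * r + 2
      shift = solve-∀
      m≡ : m ≡ 4 + 3 * j + 2 * r + j * r
      m≡ = +-cancelʳ-≡ 2 m _ (trans m+2≡ (shift j r))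
      too-large : ∀ T → 1 ≤ T → ¬ (m * (q * T) + 2 * q ≤ 2 + j + q²-1 * T)
      too-large (suc U) _ rewrite m≡ = excess _ (expand j r U)
        where
        expand : ∀ j r U → (4 + 3 * j + 2 * r + j * r) * ((3 + r) * (1 + U)) + 2 * (3 + r)
          ≡ 2 + j + (8 + 6 * r + r * r) * (1 + U)
            + suc (7 + 6 * r + r * r + 8 * j + 6 * j * r + j * r * r
                   + U * (4 + 4 * r + r * r + 9 * j + 6 * j * r + j * r * r))
        expand = solve-∀

  reduced⇒solution : ∀ t (c : Fin (2 + t) → ℕ) → Reduced t c → IsSolution q (3 + t) c
  reduced⇒solution t c (∑≡ , W≡) = divides q-2 S≡ , trans ∑≡ (sym q^2∸1)
    where
    open ≡-Reasoning
    P E S : ℕ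
    P = q ^ (3 + t) ∸ 1
    E = q ^ (2 + t)
    S = ∑ (2 + t) (λ i → c i * (q ^ idx i ∸ 2))
    qE≡1+P : q * E ≡ 1 + P
    qE≡1+P = sym (m+[n∸m]≡n (m^n>0 q (3 + t)))
    step₁ : ∀ r E → (3 + r) * ((1 + r) * E + (5 + 2 * r)) ≡ (1 + r) * ((3 + r) * E) + (3 + r) * (5 + 2 * r)
    step₁ = solve-∀
    step₂ : ∀ r P → (1 + r) * (1 + P) + (3 + r) * (5 + 2 * r) ≡ (1 + r) * P + 2 * (8 + 6 * r + r * r)
    step₂ = solve-∀
    S≡ : S ≡ q-2 * P
    S≡ = +-cancelʳ-≡ (2 * ∑ (2 + t) c) S (q-2 * P) (begin
        S + 2 * ∑ (2 + t) c               ≡⟨ weighted-sum 1<q (2 + t) c ⟩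
        q * weight q (2 + t) c            ≡⟨ cong (q *_) W≡ ⟩
        q * (q-2 * E + 2q-1)              ≡⟨ step₁ r E ⟩
        q-2 * (q * E) + q * 2q-1          ≡⟨ cong (λ x → q-2 * x + q * 2q-1) qE≡1+P ⟩
        q-2 * (1 + P) + q * 2q-1          ≡⟨ step₂ r P ⟩
        q-2 * P + 2 * q²-1                ≡⟨ cong (λ x → q-2 * P + 2 * x) ∑≡ ⟨
        q-2 * P + 2 * ∑ (2 + t) c         ∎)

  -- What remains of the reduced system after a first digit c_1 = q - 1.
  Middle : (t : ℕ) → (Fin (1 + t) → ℕ) → Set
  Middle t d = weight q (1 + t) d ≡ q-2 * q ^ (1 + t) + 1 × ∑ (1 + t) d ≡ q²-q

  -- First digit: c_1 ≡ q - 1 (mod q).  A carry of 1 (c_1 = 2q - 1) leaves exactly the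
  -- top-heavy rest of solution B, no carry leaves the Middle system, and a carry of
  -- 2 or more violates carry-bound.
  first-digit : ∀ t (c : Fin (2 + t) → ℕ) → Reduced t c →
    (c fz ≡ 2q-1 × tail c ≗ atTop t q²-2q) ⊎ (c fz ≡ q-1 × Middle t (tail c))
  first-digit t c (∑≡ , W≡) with lowest-digit ≤-refl c (trans W≡ (split-weight r (q ^ t))) (trans ∑≡ (split-sum r))
    where
    split-weight : ∀ r T → (1 + r) * ((3 + r) * ((3 + r) * T)) + (5 + 2 * r)
                   ≡ (2 + r) + (3 + r) * ((1 + r) * ((3 + r) * T) + 1)
    split-weight = solve-∀
    split-sum : ∀ r → 8 + 6 * r + r * r ≡ (2 + r) + (3 + r) * (2 + r)
    split-sum = solve-∀
  ... | zero , c₀≡ , W'≡ , ∑'≡ =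
    inj₂ (trans c₀≡ (+-identityʳ q-1) , trans (sym (+-identityʳ _)) W'≡ , trans (sym (+-identityʳ _)) ∑'≡)
  ... | suc zero , c₀≡ , W'≡ , ∑'≡ = inj₁ (trans c₀≡ (low r) , top-unique 1<q t q²-2q (tail c)
          (trans (+-cancelʳ-≡ 1 _ _ W'≡) (regroup r (q ^ t)))
          (+-cancelʳ-≡ (1 * q) _ _ (trans ∑'≡ (high r))))
    where
    low : ∀ r → 2 + r + 1 * (3 + r) ≡ 5 + 2 * r
    low = solve-∀
    regroup : ∀ r T → (1 + r) * ((3 + r) * T) ≡ (3 + r) * (1 + r) * T
    regroup = solve-∀
    high : ∀ r → (3 + r) * (2 + r) ≡ (3 + r) * (1 + r) + 1 * (3 + r)
    high = solve-∀
  ... | suc (suc a) , _ , W'≡ , ∑'≡ = ⊥-elim (too-large (q ^ t) (m^n>0 q t) (carry-bound (tail c) W'≡ ∑'≡))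
    where
    too-large : ∀ T → 1 ≤ T → ¬ ((1 + r) * (q * T) + 1 + (2 + a) * (q * T) ≤ q²-q * T + (2 + a))
    too-large (suc U) _ = excess _ (expand r a U)
      where
      expand : ∀ r a U → (1 + r) * ((3 + r) * (1 + U)) + 1 + (2 + a) * ((3 + r) * (1 + U))
        ≡ (3 + r) * (2 + r) * (1 + U) + (2 + a) + suc (1 + r + (3 + r) * U + a * (2 + r + (3 + r) * U))
      expand = solve-∀

  second-digit : ∀ t (d : Fin (1 + t) → ℕ) → Middle t d →
    ∃ λ b → d fz ≡ 1 + b * q × weight q t (tail d) + b ≡ q-2 * q ^ t × ∑ t (tail d) + b * q ≡ q²-q-1
  second-digit t d (W≡ , ∑≡) = lowest-digit 1<q d (trans W≡ (split-weight r (q ^ t))) (trans ∑≡ (split-sum r))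
    where
    split-weight : ∀ r T → (1 + r) * ((3 + r) * T) + 1 ≡ 1 + (3 + r) * ((1 + r) * T)
    split-weight = solve-∀
    split-sum : ∀ r → (3 + r) * (2 + r) ≡ 1 + (5 + 5 * r + r * r)
    split-sum = solve-∀

  -- With a single digit left after a carry b, the weight and size equations differ by
  -- b (q - 1) = q - 1, so b = 1 and the digit is q² - 2q - 1.
  unit-carry : ∀ (g : Fin 1 → ℕ) b → weight q 1 g + b ≡ q-2 * q ^ 1 → ∑ 1 g + b * q ≡ q²-q-1 →
    b ≡ 1 × g fz ≡ q²-2q-1
  unit-carry g b W≡ ∑≡ = b≡1 , trans (sym (+-identityʳ (g fz))) (+-cancelʳ-≡ 1 _ _ (trans s+1≡ (last r)))
    where
    open ≡-Reasoning
    s = ∑ 1 g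
    s+b≡ : s + b ≡ q-2 * q ^ 1
    s+b≡ = trans (cong (_+ b) (sym (weight-one q g))) W≡
    split : ∀ s b r → s + b + b * (2 + r) ≡ s + b * (3 + r)
    split = solve-∀
    total : ∀ r → 5 + 5 * r + r * r ≡ (1 + r) * ((3 + r) * 1) + 1 * (2 + r)
    total = solve-∀
    b≡1 : b ≡ 1
    b≡1 = *-cancelʳ-≡ b 1 q-1 (+-cancelˡ-≡ (s + b) _ _ (begin
        s + b + b * q-1          ≡⟨ split s b r ⟩
        s + b * q                ≡⟨ ∑≡ ⟩
        q²-q-1                   ≡⟨ total r ⟩
        q-2 * q ^ 1 + 1 * q-1    ≡⟨ cong (_+ 1 * q-1) s+b≡ ⟨
        s + b + 1 * q-1          ∎))
    s+1≡ : s + 1 ≡ q-2 * q ^ 1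
    s+1≡ = subst (λ b → s + b ≡ q-2 * q ^ 1) b≡1 s+b≡
    last : ∀ r → (1 + r) * ((3 + r) * 1) ≡ 2 + 4 * r + r * r + 1
    last = solve-∀

  no-carry : ∀ s (g : Fin (2 + s) → ℕ) b → weight q (2 + s) g + b ≡ q-2 * q ^ (2 + s) →
    ∑ (2 + s) g + b * q ≡ q²-q-1 → b ≡ 0
  no-carry s g zero    W≡ ∑≡ = refl
  no-carry s g (suc b) W≡ ∑≡ = ⊥-elim (too-large (q ^ s) (m^n>0 q s) (carry-bound g W≡ ∑≡))
    where
    too-large : ∀ T → 1 ≤ T → ¬ (q-2 * (q * (q * T)) + (1 + b) * (q * (q * T)) ≤ q²-q-1 * (q * T) + (1 + b))
    too-large (suc U) _ = excess _ (expand r b U)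
      where
      expand : ∀ r b U → (1 + r) * ((3 + r) * ((3 + r) * (1 + U))) + (1 + b) * ((3 + r) * ((3 + r) * (1 + U)))
        ≡ (5 + 5 * r + r * r) * ((3 + r) * (1 + U)) + (1 + b)
          + suc (1 + r + (3 + r) * U + b * (8 + 6 * r + r * r + (3 + r) * (3 + r) * U))
      expand = solve-∀

  -- The remaining digits, of weight (q-2) q^{k+2} and size q² - q - 1, are forced to be
  -- q and q² - 2q - 1 at the two top positions: each lower digit is a multiple of q with
  -- no carry (no-carry), and the last carry is 1 (unit-carry).
  last-digits : ∀ k (g : Fin (2 + k) → ℕ) → weight q (2 + k) g ≡ q-2 * q ^ (2 + k) → ∑ (2 + k) g ≡ q²-q-1 →
    g ≗ atTop2 k q q²-2q-1
  last-digits k g W≡ ∑≡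
    with lowest-digit {N = q-2 * q ^ (1 + k)} {K = q²-q-1} (s≤s z≤n) g (trans W≡ (x∙yz≈y∙xz q-2 q (q ^ (1 + k)))) ∑≡
  last-digits zero g W≡ ∑≡ | h , g₀≡ , W'≡ , ∑'≡ with unit-carry (tail g) h W'≡ ∑'≡
  ... | refl , g₁≡ = λ { fz → trans g₀≡ (+-identityʳ q) ; (fs fz) → g₁≡ }
  last-digits (suc k) g W≡ ∑≡ | h , g₀≡ , W'≡ , ∑'≡ with no-carry k (tail g) h W'≡ ∑'≡
  ... | refl = λ
    { fz     → g₀≡
    ; (fs i) → last-digits k (tail g) (trans (sym (+-identityʳ _)) W'≡) (trans (sym (+-identityʳ _)) ∑'≡) i
    }

  digits⇒solB : ∀ t (c : Fin (2 + t) → ℕ) → c fz ≡ 2q-1 → tail c ≗ atTop t q²-2q →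
    ∀ i → c i ≡ solB q (3 + t) (idx i)
  digits⇒solB t c c₀≡ tail≗ fz     = trans c₀≡ (sym 2q∸1)
  digits⇒solB t c c₀≡ tail≗ (fs i) = trans (tail≗ i) (cong (λ v → atTop t v i) (sym q^2∸2q))

  solB⇒reduced : ∀ t (c : Fin (2 + t) → ℕ) → (∀ i → c i ≡ solB q (3 + t) (idx i)) → Reduced t c
  solB⇒reduced t c H =
      trans (cong₂ _+_ c₀≡ (trans (∑-cong (1 + t) tail≗) (∑-atTop t q²-2q))) (sum r)
    , trans (weight-suc q (1 + t) c)
        (trans (cong₂ (λ x y → x + q * y) c₀≡ (trans (weight-cong q (1 + t) tail≗) (weight-atTop q t q²-2q)))
               (wsum r (q ^ t)))
    where
    c₀≡ : c fz ≡ 2q-1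
    c₀≡ = trans (H fz) 2q∸1
    tail≗ : tail c ≗ atTop t q²-2q
    tail≗ i = trans (H (fs i)) (cong (λ v → atTop t v i) q^2∸2q)
    sum : ∀ r → 5 + 2 * r + (3 + r) * (1 + r) ≡ 8 + 6 * r + r * r
    sum = solve-∀
    wsum : ∀ r T → 5 + 2 * r + (3 + r) * ((3 + r) * (1 + r) * T) ≡ (1 + r) * ((3 + r) * ((3 + r) * T)) + (5 + 2 * r)
    wsum = solve-∀

  solA4⇒reduced : ∀ (c : Fin 3 → ℕ) → (∀ i → c i ≡ solA4 q (idx i)) → Reduced 1 c
  solA4⇒reduced c H =
      trans (∑-cong 3 H) (trans (cong (λ v → q-1 + (q + 1 + (v + 0))) q^2∸2q∸1) (sum r))
    , trans (weight-cong q 3 H)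
        (trans (cong (λ v → q-1 * 1 + ((q + 1) * (q * 1) + (v * (q * (q * 1)) + 0))) q^2∸2q∸1) (wsum r))
    where
    sum : ∀ r → 2 + r + (3 + r + 1 + (2 + 4 * r + r * r + 0)) ≡ 8 + 6 * r + r * r
    sum = solve-∀
    wsum : ∀ r → (2 + r) * 1 + ((3 + r + 1) * ((3 + r) * 1) + ((2 + 4 * r + r * r) * ((3 + r) * ((3 + r) * 1)) + 0))
           ≡ (1 + r) * ((3 + r) * ((3 + r) * ((3 + r) * 1))) + (5 + 2 * r)
    wsum = solve-∀

  solA5⇒reduced : ∀ s (c : Fin (4 + s) → ℕ) → (∀ i → c i ≡ solA5 q (5 + s) (idx i)) → Reduced (2 + s) c
  solA5⇒reduced s c H =
      trans (cong₂ _+_ (H fz) (cong₂ _+_ (H (fs fz)) (trans (∑-cong (2 + s) rest≗) (∑-atTop2 s q q²-2q-1)))) (sum r)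
    , trans (weight-suc q (3 + s) c)
        (trans (cong (λ y → c fz + q * y) (weight-suc q (2 + s) (tail c)))
          (trans (cong₂ (λ x y → x + q * y) (H fz) (cong₂ (λ x y → x + q * y) (H (fs fz))
                   (trans (weight-cong q (2 + s) rest≗) (weight-atTop2 q s q q²-2q-1))))
                 (wsum r (q ^ s))))
    where
    rest≗ : tail (tail c) ≗ atTop2 s q q²-2q-1
    rest≗ i = trans (H (fs (fs i))) (cong (λ v → atTop2 s q v i) q^2∸2q∸1)
    sum : ∀ r → 2 + r + (1 + (3 + r + (2 + 4 * r + r * r))) ≡ 8 + 6 * r + r * r
    sum = solve-∀
    wsum : ∀ r T → 2 + r + (3 + r) * (1 + (3 + r) * ((3 + r + (2 + 4 * r + r * r) * (3 + r)) * T))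
           ≡ (1 + r) * ((3 + r) * ((3 + r) * ((3 + r) * ((3 + r) * T)))) + (5 + 2 * r)
    wsum = solve-∀

  digits⇒solA4 : ∀ (c : Fin 3 → ℕ) → c fz ≡ q-1 → c (fs fz) ≡ q + 1 → c (fs (fs fz)) ≡ q²-2q-1 →
    ∀ i → c i ≡ solA4 q (idx i)
  digits⇒solA4 c c₀≡ c₁≡ c₂≡ fz           = c₀≡
  digits⇒solA4 c c₀≡ c₁≡ c₂≡ (fs fz)      = c₁≡
  digits⇒solA4 c c₀≡ c₁≡ c₂≡ (fs (fs fz)) = trans c₂≡ (sym q^2∸2q∸1)

  digits⇒solA5 : ∀ s (c : Fin (4 + s) → ℕ) → c fz ≡ q-1 → c (fs fz) ≡ 1 → tail (tail c) ≗ atTop2 s q q²-2q-1 →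
    ∀ i → c i ≡ solA5 q (5 + s) (idx i)
  digits⇒solA5 s c c₀≡ c₁≡ rest≗ fz          = c₀≡
  digits⇒solA5 s c c₀≡ c₁≡ rest≗ (fs fz)     = c₁≡
  digits⇒solA5 s c c₀≡ c₁≡ rest≗ (fs (fs i)) = trans (rest≗ i) (cong (λ v → atTop2 s q v i) (sym q^2∸2q∸1))

  -- e = 3: the Middle system has no solution with a single digit, since its second
  -- digit would leave nothing to carry into.
  no-middle-e3 : ∀ (d : Fin 1 → ℕ) → ¬ Middle 0 d
  no-middle-e3 d middle =
    let (b , _ , b≡ , bq≡) = second-digit 0 d middle
    in excess (1 + r) (expand r) (≤-reflexive (sym (subst (λ x → x * q ≡ q²-q-1) b≡ bq≡)))
    where
    expand : ∀ r → 5 + 5 * r + r * r ≡ (1 + r) * 1 * (3 + r) + suc (1 + r)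
    expand = solve-∀

  -- e = 4: the last digit absorbs a carry of exactly 1, so c_2 = q + 1 and c_3 = q² - 2q - 1.
  middle-e4 : ∀ (d : Fin 2 → ℕ) → Middle 1 d → d fz ≡ q + 1 × d (fs fz) ≡ q²-2q-1
  middle-e4 d middle =
    let (b , d₀≡ , W≡ , ∑≡) = second-digit 1 d middle
        (b≡1 , d₁≡)         = unit-carry (tail d) b W≡ ∑≡
    in trans d₀≡ (trans (cong (λ b → 1 + b * q) b≡1) (trans (+-comm 1 (1 * q)) (cong (_+ 1) (*-identityˡ q))))
     , d₁≡

  -- e ≥ 5: there is no carry, so c_2 = 1, and last-digits fixes the remaining digits.
  middle-e5 : ∀ s (d : Fin (3 + s) → ℕ) → Middle (2 + s) d → d fz ≡ 1 × tail d ≗ atTop2 s q q²-2q-1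
  middle-e5 s d middle =
    let (b , d₀≡ , W≡ , ∑≡) = second-digit (2 + s) d middle
        b≡0                 = no-carry s (tail d) b W≡ ∑≡
    in trans d₀≡ (cong (λ b → 1 + b * q) b≡0)
     , last-digits s (tail d)
         (trans (sym (+-identityʳ _)) (subst (λ b → weight q (2 + s) (tail d) + b ≡ q-2 * q ^ (2 + s)) b≡0 W≡))
         (trans (sym (+-identityʳ _)) (subst (λ b → ∑ (2 + s) (tail d) + b * q ≡ q²-q-1) b≡0 ∑≡))

  -- The reduced system for e = 3: the first digit must carry, giving solution B.
  reduced-e3 : ∀ (c : Fin 2 → ℕ) → Reduced 0 c → ∀ i → c i ≡ solB q 3 (idx i)
  reduced-e3 c red = [ uncurry (digits⇒solB 0 c) , ⊥-elim ∘ no-middle-e3 (tail c) ∘ proj₂ ] (first-digit 0 c red)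

  reduced-e4 : ∀ (c : Fin 3 → ℕ) → Reduced 1 c →
    (∀ i → c i ≡ solA4 q (idx i)) ⊎ (∀ i → c i ≡ solB q 4 (idx i))
  reduced-e4 c red = [ inj₂ ∘ uncurry (digits⇒solB 1 c) , inj₁ ∘ solA4-case ] (first-digit 1 c red)
    where
    solA4-case : c fz ≡ q-1 × Middle 1 (tail c) → ∀ i → c i ≡ solA4 q (idx i)
    solA4-case (c₀≡ , middle) = let (c₁≡ , c₂≡) = middle-e4 (tail c) middle in digits⇒solA4 c c₀≡ c₁≡ c₂≡

  reduced-e5 : ∀ s (c : Fin (4 + s) → ℕ) → Reduced (2 + s) c →
    (∀ i → c i ≡ solA5 q (5 + s) (idx i)) ⊎ (∀ i → c i ≡ solB q (5 + s) (idx i))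
  reduced-e5 s c red = [ inj₂ ∘ uncurry (digits⇒solB (2 + s) c) , inj₁ ∘ solA5-case ] (first-digit (2 + s) c red)
    where
    solA5-case : c fz ≡ q-1 × Middle (2 + s) (tail c) → ∀ i → c i ≡ solA5 q (5 + s) (idx i)
    solA5-case (c₀≡ , middle) = let (c₁≡ , rest≗) = middle-e5 s (tail c) middle in digits⇒solA5 s c c₀≡ c₁≡ rest≗

  characterisation-e3 : ∀ (c : Fin 2 → ℕ) → IsSolution q 3 c ⇔ (∀ i → c i ≡ solB q 3 (idx i))
  characterisation-e3 c = mk⇔ (reduced-e3 c ∘ solution⇒reduced 0 c) (reduced⇒solution 0 c ∘ solB⇒reduced 0 c)

  characterisation-e4 : ∀ (c : Fin 3 → ℕ) →
    IsSolution q 4 c ⇔ ((∀ i → c i ≡ solA4 q (idx i)) ⊎ (∀ i → c i ≡ solB q 4 (idx i)))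
  characterisation-e4 c = mk⇔ (reduced-e4 c ∘ solution⇒reduced 1 c)
    (reduced⇒solution 1 c ∘ [ solA4⇒reduced c , solB⇒reduced 1 c ])

  characterisation-e5 : ∀ s (c : Fin (4 + s) → ℕ) →
    IsSolution q (5 + s) c ⇔ ((∀ i → c i ≡ solA5 q (5 + s) (idx i)) ⊎ (∀ i → c i ≡ solB q (5 + s) (idx i)))
  characterisation-e5 s c = mk⇔ (reduced-e5 s c ∘ solution⇒reduced (2 + s) c)
    (reduced⇒solution (2 + s) c ∘ [ solA5⇒reduced s c , solB⇒reduced (2 + s) c ])

odd-prime-power-≥3 : ∀ {q} → OddPrimePower q → ∃ λ r → q ≡ 3 + r
odd-prime-power-≥3 (zero , _ , p-prime , _)                   = ⊥-elim (¬prime[0] p-prime)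
odd-prime-power-≥3 (suc zero , _ , p-prime , _)               = ⊥-elim (¬prime[1] p-prime)
odd-prime-power-≥3 (suc (suc zero) , _ , _ , p≢2 , _)         = ⊥-elim (p≢2 refl)
odd-prime-power-≥3 (suc (suc (suc p)) , zero , _ , _ , () , _)
odd-prime-power-≥3 {q} (suc (suc (suc p)) , suc k , _ , _ , _ , q≡) = q ∸ 3 , sym (m+[n∸m]≡n 3≤q)
  where
  3≤q : 3 ≤ q
  3≤q = subst (3 ≤_) (sym q≡) (*-mono-≤ {3} {3 + p} {1} {(3 + p) ^ k} (s≤s (s≤s (s≤s z≤n))) (m^n>0 (3 + p) k))

classify : ∀ r e → 3 ≤ e → (c : Fin (e ∸ 1) → ℕ) →
      (5 ≤ e → (IsSolution (3 + r) e c ⇔ ((∀ i → c i ≡ solA5 (3 + r) e (idx i)) ⊎ (∀ i → c i ≡ solB (3 + r) e (idx i)))))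
    × (e ≡ 4 → (IsSolution (3 + r) e c ⇔ ((∀ i → c i ≡ solA4 (3 + r) (idx i)) ⊎ (∀ i → c i ≡ solB (3 + r) e (idx i)))))
    × (e ≡ 3 → (IsSolution (3 + r) e c ⇔ (∀ i → c i ≡ solB (3 + r) e (idx i))))
classify r 1 (s≤s ()) c
classify r 2 (s≤s (s≤s ())) c
classify r 3 _ c = (λ { (s≤s (s≤s (s≤s ()))) }) , (λ ()) , λ _ → characterisation-e3 r c
classify r 4 _ c = (λ { (s≤s (s≤s (s≤s (s≤s ())))) }) , (λ _ → characterisation-e4 r c) , λ ()
classify r (suc (suc (suc (suc (suc s))))) _ c = (λ _ → characterisation-e5 r s c) , (λ ()) , λ ()

lemma6p5 : (q e : ℕ) → OddPrimePower q → 3 ≤ e → (c : Fin (e ∸ 1) → ℕ) →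
      (5 ≤ e → (IsSolution q e c ⇔ ((∀ i → c i ≡ solA5 q e (idx i)) ⊎ (∀ i → c i ≡ solB q e (idx i)))))
    × (e ≡ 4 → (IsSolution q e c ⇔ ((∀ i → c i ≡ solA4 q (idx i)) ⊎ (∀ i → c i ≡ solB q e (idx i)))))
    × (e ≡ 3 → (IsSolution q e c ⇔ (∀ i → c i ≡ solB q e (idx i))))
lemma6p5 q e odd 3≤e c with odd-prime-power-≥3 odd
... | r , refl = classify r e 3≤e c
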